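{- Let $(\mathsf T,\mu,\eta,\mathsf n,\mathsf n_K)$ be a symmetric comonoidal monad and $(!,\delta,\varepsilon,\Delta,\mathsf e)$ a coalgebra modality on the same symmetric monoidal category $(\mathbb X,\otimes,K)$, and let $\lambda$ be a coalgebra mixed distributive law of the former over the latter. If $(A,\omega)$ is a $!$-coalgebra and $\omega^\flat:=\lambda_A\circ\mathsf T(\omega):\mathsf TA\to!\mathsf TA$, then $\mathsf n_{A,A}\circ\mathsf T(\Delta^\omega)=\Delta^{\omega^\flat}$ and $\mathsf n_K\circ\mathsf T(\mathsf e^\omega)=\mathsf e^{\omega^\flat}$, where for a $!$-coalgebra $(B,\gamma)$ we write $\Delta^\gamma=(\varepsilon_B\otimes\varepsilon_B)\circ\Delta_B\circ\gamma:B\to B\otimes B$ and $\mathsf e^\gamma=\mathsf e_B\circ\gamma:B\to K$.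
   Context: Composition is written $g\circ f$. Symmetric comonoidal monad $(\mathsf T,\mu,\eta,\mathsf n,\mathsf n_K)$: a monad with natural $\mathsf n_{A,B}:\mathsf T(A\otimes B)\to\mathsf TA\otimes\mathsf TB$, $\mathsf n_K:\mathsf TK\to K$ making $\mathsf T$ symmetric comonoidal, with $\mu,\eta$ comonoidal transformations ($\mathsf n_{A,B}\circ\mu_{A\otimes B}=(\mu_A\otimes\mu_B)\circ\mathsf n_{\mathsf TA,\mathsf TB}\circ\mathsf T(\mathsf n_{A,B})$, $\mathsf n_K\circ\mu_K=\mathsf n_K\circ\mathsf T(\mathsf n_K)$, $\mathsf n_{A,B}\circ\eta_{A\otimes B}=\eta_A\otimes\eta_B$, $\mathsf n_K\circ\eta_K=1_K$). Coalgebra modality: comonad $(!,\delta,\varepsilon)$ with natural $\Delta_A:!A\to!A\otimes!A$, $\mathsf e_A:!A\to K$ making each $!A$ a cocommutative comonoid and $\delta_A$ a comonoid morphism. A $!$-coalgebra is $(A,\omega)$ with $\omega:A\to!A$, $\varepsilon_A\circ\omega=1_A$, $\delta_A\circ\omega=!(\omega)\circ\omega$. A coalgebra mixed distributive law is a natural $\lambda_A:\mathsf T!A\to!\mathsf TA$ with $\lambda_A\circ\mu_{!A}=!(\mu_A)\circ\lambda_{\mathsf TA}\circ\mathsf T(\lambda_A)$, $\lambda_A\circ\eta_{!A}=!(\eta_A)$, $\delta_{\mathsf TA}\circ\lambda_A=!(\lambda_A)\circ\lambda_{!A}\circ\mathsf T(\delta_A)$, $\varepsilon_{\mathsf TA}\circ\lambda_A=\mathsf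 T(\varepsilon_A)$, $\Delta_{\mathsf TA}\circ\lambda_A=(\lambda_A\otimes\lambda_A)\circ\mathsf n_{!A,!A}\circ\mathsf T(\Delta_A)$, $\mathsf e_{\mathsf TA}\circ\lambda_A=\mathsf n_K\circ\mathsf T(\mathsf e_A)$. -}

module Defs where

open import Level using (Level; _⊔_; suc)
open import Relation.Binary.Structures using (IsEquivalence)
open import Data.Product using (_×_)

record Category (o ℓ q : Level) : Set (suc (o ⊔ ℓ ⊔ q)) where
  infixr 9 _∘_
  infix  4 _≈_
  infix  5 _⇒_
  field
    Obj  : Set o
    _⇒_  : Obj → Obj → Set ℓ
    _≈_  : ∀ {A B} → A ⇒ B → A ⇒ B → Set q
    id   : ∀ {A} → A ⇒ A
    _∘_  : ∀ {A B C} → B ⇒ C → A ⇒ B → A ⇒ C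
    ≈-equiv    : ∀ {A B} → IsEquivalence (_≈_ {A} {B})
    assoc      : ∀ {A B C D} {f : A ⇒ B} {g : B ⇒ C} {h : C ⇒ D} →
                 (h ∘ g) ∘ f ≈ h ∘ (g ∘ f)
    identityˡ  : ∀ {A B} {f : A ⇒ B} → id ∘ f ≈ f
    identityʳ  : ∀ {A B} {f : A ⇒ B} → f ∘ id ≈ f
    ∘-resp-≈   : ∀ {A B C} {f h : B ⇒ C} {g i : A ⇒ B} →
                 f ≈ h → g ≈ i → f ∘ g ≈ h ∘ i

record Endofunctor {o ℓ q} (C : Category o ℓ q) : Set (o ⊔ ℓ ⊔ q) where
  open Category C
  field
    F₀ : Obj → Obj
    F₁ : ∀ {A B} → A ⇒ B → F₀ A ⇒ F₀ B
    identity     : ∀ {A} → F₁ (id {A}) ≈ id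
    homomorphism : ∀ {A B C} {f : A ⇒ B} {g : B ⇒ C} → F₁ (g ∘ f) ≈ F₁ g ∘ F₁ f
    F-resp-≈     : ∀ {A B} {f g : A ⇒ B} → f ≈ g → F₁ f ≈ F₁ g

record SymmetricMonoidal {o ℓ q} (C : Category o ℓ q) : Set (o ⊔ ℓ ⊔ q) where
  open Category C
  infixr 10 _⊗₀_ _⊗₁_
  field
    _⊗₀_ : Obj → Obj → Obj
    _⊗₁_ : ∀ {A B C D} → A ⇒ B → C ⇒ D → (A ⊗₀ C) ⇒ (B ⊗₀ D)
    K    : Obj
    ⊗-identity : ∀ {A B} → id {A} ⊗₁ id {B} ≈ id
    ⊗-homomorphism : ∀ {A B C D E F} {f : A ⇒ B} {g : B ⇒ C} {h : D ⇒ E} {k : E ⇒ F} →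
                     (g ∘ f) ⊗₁ (k ∘ h) ≈ (g ⊗₁ k) ∘ (f ⊗₁ h)
    ⊗-resp-≈ : ∀ {A B C D} {f f' : A ⇒ B} {g g' : C ⇒ D} →
               f ≈ f' → g ≈ g' → f ⊗₁ g ≈ f' ⊗₁ g'
    α⇒ : ∀ {A B C} → (A ⊗₀ B) ⊗₀ C ⇒ A ⊗₀ (B ⊗₀ C)
    α⇐ : ∀ {A B C} → A ⊗₀ (B ⊗₀ C) ⇒ (A ⊗₀ B) ⊗₀ C
    α-isoˡ : ∀ {A B C} → α⇐ {A} {B} {C} ∘ α⇒ ≈ id
    α-isoʳ : ∀ {A B C} → α⇒ {A} {B} {C} ∘ α⇐ ≈ id
    α-natural : ∀ {A B C D E F} {f : A ⇒ B} {g : C ⇒ D} {h : E ⇒ F} →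
                α⇒ ∘ ((f ⊗₁ g) ⊗₁ h) ≈ (f ⊗₁ (g ⊗₁ h)) ∘ α⇒
    λ⇒ : ∀ {A} → K ⊗₀ A ⇒ A
    λ⇐ : ∀ {A} → A ⇒ K ⊗₀ A
    λ-isoˡ : ∀ {A} → λ⇐ {A} ∘ λ⇒ ≈ id
    λ-isoʳ : ∀ {A} → λ⇒ {A} ∘ λ⇐ ≈ id
    λ-natural : ∀ {A B} {f : A ⇒ B} → λ⇒ ∘ (id ⊗₁ f) ≈ f ∘ λ⇒
    ρ⇒ : ∀ {A} → A ⊗₀ K ⇒ A
    ρ⇐ : ∀ {A} → A ⇒ A ⊗₀ K
    ρ-isoˡ : ∀ {A} → ρ⇐ {A} ∘ ρ⇒ ≈ id
    ρ-isoʳ : ∀ {A} → ρ⇒ {A} ∘ ρ⇐ ≈ id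
    ρ-natural : ∀ {A B} {f : A ⇒ B} → ρ⇒ ∘ (f ⊗₁ id) ≈ f ∘ ρ⇒
    σ : ∀ {A B} → A ⊗₀ B ⇒ B ⊗₀ A
    σ-natural : ∀ {A B C D} {f : A ⇒ B} {g : C ⇒ D} →
                σ ∘ (f ⊗₁ g) ≈ (g ⊗₁ f) ∘ σ
    σ-involutive : ∀ {A B} → σ {B} {A} ∘ σ {A} {B} ≈ id
    pentagon : ∀ {A B C D} →
               α⇒ {A} {B} {C ⊗₀ D} ∘ α⇒ {A ⊗₀ B} {C} {D}
               ≈ (id ⊗₁ α⇒) ∘ (α⇒ {A} {B ⊗₀ C} {D} ∘ (α⇒ ⊗₁ id))
    triangle : ∀ {A B} → (id {A} ⊗₁ λ⇒ {B}) ∘ α⇒ ≈ ρ⇒ ⊗₁ id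
    hexagon  : ∀ {A B C} →
               α⇒ {B} {C} {A} ∘ (σ {A} {B ⊗₀ C} ∘ α⇒ {A} {B} {C})
               ≈ (id ⊗₁ σ) ∘ (α⇒ {B} {A} {C} ∘ (σ ⊗₁ id))

record SymComonoidalMonad {o ℓ q} {C : Category o ℓ q}
                          (M : SymmetricMonoidal C) : Set (o ⊔ ℓ ⊔ q) where
  open Category C
  open SymmetricMonoidal M
  field
    T : Endofunctor C
  open Endofunctor T renaming (F₀ to T₀; F₁ to T₁)
  field
    μ : ∀ {A} → T₀ (T₀ A) ⇒ T₀ A
    η : ∀ {A} → A ⇒ T₀ A
    μ-natural : ∀ {A B} {f : A ⇒ B} → μ ∘ T₁ (T₁ f) ≈ T₁ f ∘ μ
    η-natural : ∀ {A B} {f : A ⇒ B} → η ∘ f ≈ T₁ f ∘ η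
    μ-assoc   : ∀ {A} → μ {A} ∘ T₁ μ ≈ μ ∘ μ
    μ-identityˡ : ∀ {A} → μ {A} ∘ T₁ η ≈ id
    μ-identityʳ : ∀ {A} → μ {A} ∘ η ≈ id
    n  : ∀ {A B} → T₀ (A ⊗₀ B) ⇒ T₀ A ⊗₀ T₀ B
    nK : T₀ K ⇒ K
    n-natural : ∀ {A B C D} {f : A ⇒ B} {g : C ⇒ D} →
                n ∘ T₁ (f ⊗₁ g) ≈ (T₁ f ⊗₁ T₁ g) ∘ n
    n-assoc : ∀ {A B C} →
              α⇒ ∘ ((n {A} {B} ⊗₁ id) ∘ n {A ⊗₀ B} {C})
              ≈ (id ⊗₁ n {B} {C}) ∘ (n {A} {B ⊗₀ C} ∘ T₁ α⇒)
    n-unitˡ : ∀ {A} → λ⇒ ∘ ((nK ⊗₁ id) ∘ n {K} {A}) ≈ T₁ λ⇒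
    n-unitʳ : ∀ {A} → ρ⇒ ∘ ((id ⊗₁ nK) ∘ n {A} {K}) ≈ T₁ ρ⇒
    n-symmetric : ∀ {A B} → σ ∘ n {A} {B} ≈ n {B} {A} ∘ T₁ σ
    μ-n  : ∀ {A B} → n {A} {B} ∘ μ ≈ (μ ⊗₁ μ) ∘ (n ∘ T₁ n)
    μ-nK : nK ∘ μ ≈ nK ∘ T₁ nK
    η-n  : ∀ {A B} → n {A} {B} ∘ η ≈ η ⊗₁ η
    η-nK : nK ∘ η ≈ id

record CoalgebraModality {o ℓ q} {C : Category o ℓ q}
                         (M : SymmetricMonoidal C) : Set (o ⊔ ℓ ⊔ q) where
  open Category C
  open SymmetricMonoidal M
  field
    B : Endofunctor C
  open Endofunctor B renaming (F₀ to !₀; F₁ to !₁)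
  field
    δ : ∀ {A} → !₀ A ⇒ !₀ (!₀ A)
    ε : ∀ {A} → !₀ A ⇒ A
    δ-natural : ∀ {A B} {f : A ⇒ B} → δ ∘ !₁ f ≈ !₁ (!₁ f) ∘ δ
    ε-natural : ∀ {A B} {f : A ⇒ B} → ε ∘ !₁ f ≈ f ∘ ε
    δ-assoc   : ∀ {A} → δ ∘ δ {A} ≈ !₁ δ ∘ δ
    ε-identityˡ : ∀ {A} → !₁ ε ∘ δ {A} ≈ id
    ε-identityʳ : ∀ {A} → ε ∘ δ {A} ≈ id
    Δ : ∀ {A} → !₀ A ⇒ !₀ A ⊗₀ !₀ A
    e : ∀ {A} → !₀ A ⇒ K
    Δ-natural : ∀ {A B} {f : A ⇒ B} → Δ ∘ !₁ f ≈ (!₁ f ⊗₁ !₁ f) ∘ Δ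
    e-natural : ∀ {A B} {f : A ⇒ B} → e ∘ !₁ f ≈ e
    Δ-coassoc : ∀ {A} → α⇒ ∘ ((Δ ⊗₁ id) ∘ Δ {A}) ≈ (id ⊗₁ Δ) ∘ Δ
    Δ-counitˡ : ∀ {A} → λ⇒ ∘ ((e ⊗₁ id) ∘ Δ {A}) ≈ id
    Δ-counitʳ : ∀ {A} → ρ⇒ ∘ ((id ⊗₁ e) ∘ Δ {A}) ≈ id
    Δ-cocomm  : ∀ {A} → σ ∘ Δ {A} ≈ Δ
    δ-Δ : ∀ {A} → Δ ∘ δ {A} ≈ (δ ⊗₁ δ) ∘ Δ
    δ-e : ∀ {A} → e ∘ δ {A} ≈ e

record Coalgebra {o ℓ q} {C : Category o ℓ q} {M : SymmetricMonoidal C}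
                 (Bang : CoalgebraModality M) : Set (o ⊔ ℓ ⊔ q) where
  open Category C
  open CoalgebraModality Bang
  open Endofunctor B renaming (F₀ to !₀; F₁ to !₁)
  field
    A : Obj
    ω : A ⇒ !₀ A
    ω-counit : ε ∘ ω ≈ id
    ω-coassoc : δ ∘ ω ≈ !₁ ω ∘ ω

record CoalgebraMixedDistLaw {o ℓ q} {C : Category o ℓ q} {M : SymmetricMonoidal C}
                             (𝕋 : SymComonoidalMonad M) (Bang : CoalgebraModality M)
                             : Set (o ⊔ ℓ ⊔ q) where
  open Category C
  open SymmetricMonoidal M
  open SymComonoidalMonad 𝕋
  open Endofunctor T renaming (F₀ to T₀; F₁ to T₁)
  open CoalgebraModality Bang
  open Endofunctor B renaming (F₀ to !₀; F₁ to !₁)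
  field
    lam : ∀ {A} → T₀ (!₀ A) ⇒ !₀ (T₀ A)
    lam-natural : ∀ {A B} {f : A ⇒ B} → lam ∘ T₁ (!₁ f) ≈ !₁ (T₁ f) ∘ lam
    lam-μ : ∀ {A} → lam {A} ∘ μ ≈ !₁ μ ∘ (lam ∘ T₁ lam)
    lam-η : ∀ {A} → lam {A} ∘ η ≈ !₁ η
    lam-δ : ∀ {A} → δ ∘ lam {A} ≈ !₁ lam ∘ (lam ∘ T₁ δ)
    lam-ε : ∀ {A} → ε ∘ lam {A} ≈ T₁ ε
    lam-Δ : ∀ {A} → Δ ∘ lam {A} ≈ (lam ⊗₁ lam) ∘ (n ∘ T₁ Δ)
    lam-e : ∀ {A} → e ∘ lam {A} ≈ nK ∘ T₁ e

module Derived {o ℓ q} {C : Category o ℓ q} {M : SymmetricMonoidal C}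
               {𝕋 : SymComonoidalMonad M} {Bang : CoalgebraModality M}
               (L : CoalgebraMixedDistLaw 𝕋 Bang) where
  open Category C
  open SymmetricMonoidal M
  open SymComonoidalMonad 𝕋
  open Endofunctor T renaming (F₀ to T₀; F₁ to T₁)
  open CoalgebraModality Bang
  open Endofunctor B renaming (F₀ to !₀; F₁ to !₁)
  open CoalgebraMixedDistLaw L

  Δ^ : ∀ {X} → X ⇒ !₀ X → X ⇒ X ⊗₀ X
  Δ^ γ = (ε ⊗₁ ε) ∘ (Δ ∘ γ)

  e^ : ∀ {X} → X ⇒ !₀ X → X ⇒ K
  e^ γ = e ∘ γ

  _♭ : ∀ {X} → X ⇒ !₀ X → T₀ X ⇒ !₀ (T₀ X)
  ω ♭ = lam ∘ T₁ ω

  Lemma6·2 : Coalgebra Bang → Set q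
  Lemma6·2 Co =
    (n ∘ T₁ (Δ^ ω) ≈ Δ^ (ω ♭)) × (nK ∘ T₁ (e^ ω) ≈ e^ (ω ♭))
    where open Coalgebra Co

module Submission where

open import Level using (Level)
open import Data.Product using (_,_)
open import Relation.Binary.Bundles using (Setoid)
import Relation.Binary.Reasoning.Setoid as SetoidReasoning
open import Defs

-- Both equations hold for every γ : X → !X, not just for coalgebra structures:
-- λ carries Δ to n ∘ T(Δ) and ε to T(ε), so the cofree comultiplication
-- (ε ⊗ ε) ∘ Δ and the counit e commute with λ up to n and n_K, and
-- precomposing with T(γ) gives the claim.

module MixedDistLawProperties
  {o ℓ q} {C : Category o ℓ q} {M : SymmetricMonoidal C}
  {𝕋 : SymComonoidalMonad M} {Bang : CoalgebraModality M}
  (L : CoalgebraMixedDistLaw 𝕋 Bang) where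

  open Category C
  open SymmetricMonoidal M
  open SymComonoidalMonad 𝕋
  open Endofunctor T renaming (F₀ to T₀; F₁ to T₁)
  open CoalgebraModality Bang
  open Endofunctor B using () renaming (F₀ to !₀)
  open CoalgebraMixedDistLaw L
  open Derived L

  hom-setoid : Obj → Obj → Setoid ℓ q
  hom-setoid X Y = record { Carrier = X ⇒ Y ; _≈_ = _≈_ ; isEquivalence = ≈-equiv }

  open module HomReasoning {X Y} = SetoidReasoning (hom-setoid X Y)

  refl≈ : ∀ {X Y} {f : X ⇒ Y} → f ≈ f
  refl≈ {X} {Y} = Setoid.refl (hom-setoid X Y)

  Δε : ∀ {X} → !₀ X ⇒ X ⊗₀ X
  Δε = (ε ⊗₁ ε) ∘ Δ

  Δε-lam : ∀ {X} → Δε ∘ lam {X} ≈ n ∘ T₁ Δε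
  Δε-lam = begin
    ((ε ⊗₁ ε) ∘ Δ) ∘ lam                    ≈⟨ assoc ⟩
    (ε ⊗₁ ε) ∘ (Δ ∘ lam)                    ≈⟨ ∘-resp-≈ refl≈ lam-Δ ⟩
    (ε ⊗₁ ε) ∘ ((lam ⊗₁ lam) ∘ (n ∘ T₁ Δ))  ≈˘⟨ assoc ⟩
    ((ε ⊗₁ ε) ∘ (lam ⊗₁ lam)) ∘ (n ∘ T₁ Δ)  ≈˘⟨ ∘-resp-≈ ⊗-homomorphism refl≈ ⟩
    ((ε ∘ lam) ⊗₁ (ε ∘ lam)) ∘ (n ∘ T₁ Δ)   ≈⟨ ∘-resp-≈ (⊗-resp-≈ lam-ε lam-ε) refl≈ ⟩
    (T₁ ε ⊗₁ T₁ ε) ∘ (n ∘ T₁ Δ)             ≈˘⟨ assoc ⟩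
    ((T₁ ε ⊗₁ T₁ ε) ∘ n) ∘ T₁ Δ             ≈˘⟨ ∘-resp-≈ n-natural refl≈ ⟩
    (n ∘ T₁ (ε ⊗₁ ε)) ∘ T₁ Δ                ≈⟨ assoc ⟩
    n ∘ (T₁ (ε ⊗₁ ε) ∘ T₁ Δ)                ≈˘⟨ ∘-resp-≈ refl≈ homomorphism ⟩
    n ∘ T₁ Δε                               ∎

  n-T-Δ^ : ∀ {X} (γ : X ⇒ !₀ X) → n ∘ T₁ (Δ^ γ) ≈ Δ^ (γ ♭)
  n-T-Δ^ γ = begin
    n ∘ T₁ ((ε ⊗₁ ε) ∘ (Δ ∘ γ))   ≈˘⟨ ∘-resp-≈ refl≈ (F-resp-≈ assoc) ⟩
    n ∘ T₁ (Δε ∘ γ)               ≈⟨ ∘-resp-≈ refl≈ homomorphism ⟩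
    n ∘ (T₁ Δε ∘ T₁ γ)            ≈˘⟨ assoc ⟩
    (n ∘ T₁ Δε) ∘ T₁ γ            ≈˘⟨ ∘-resp-≈ Δε-lam refl≈ ⟩
    (Δε ∘ lam) ∘ T₁ γ             ≈⟨ assoc ⟩
    ((ε ⊗₁ ε) ∘ Δ) ∘ (lam ∘ T₁ γ) ≈⟨ assoc ⟩
    Δ^ (γ ♭)                      ∎

  nK-T-e^ : ∀ {X} (γ : X ⇒ !₀ X) → nK ∘ T₁ (e^ γ) ≈ e^ (γ ♭)
  nK-T-e^ γ = begin
    nK ∘ T₁ (e ∘ γ)          ≈⟨ ∘-resp-≈ refl≈ homomorphism ⟩
    nK ∘ (T₁ e ∘ T₁ γ)       ≈˘⟨ assoc ⟩
    (nK ∘ T₁ e) ∘ T₁ γ       ≈˘⟨ ∘-resp-≈ lam-e refl≈ ⟩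
    (e ∘ lam) ∘ T₁ γ         ≈⟨ assoc ⟩
    e^ (γ ♭)                 ∎

lemma6p2 : ∀ {o ℓ q : Level} {C : Category o ℓ q} {M : SymmetricMonoidal C}
    (𝕋 : SymComonoidalMonad M) (Bang : CoalgebraModality M)
    (L : CoalgebraMixedDistLaw 𝕋 Bang) (X : Coalgebra Bang) →
    Derived.Lemma6·2 L X
lemma6p2 𝕋 Bang L X = n-T-Δ^ ω , nK-T-e^ ω
  where
  open MixedDistLawProperties L
  open Coalgebra X
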